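{- Let $T$ be a neutral tree on $n_1\geq 7$ vertices. Then the graph $T^{\dagger}$ obtained from $T$ by the leaf-connecting-operation is neutral.
   Context: The leaf-connecting-operation applied to a graph $G$: (1) for each vertex $v$ of $G$, attach $d_v$ new vertices of degree one (leaves) adjacent to $v$, where $d_v$ is the degree of $v$ in $G$; (2) then repeatedly join a pair of (remaining) leaves by an edge, until no leaf is left. The resulting graph is $G^{\dagger}$ (any such pairing). For a simple connected graph $G=(V,E)$ with $m\geq1$ edges, where $e_{uv}$ denotes the edge with endpoints $u,v$, the assortativity coefficient is $$r=\frac{m^{ -1}\sum_{e_{uv}\in E} d_{u}d_{v}-\Big[m^{ -1}\sum_{e_{uv}\in E} \tfrac{1}{2}(d_{u}+d_{v})\Big]^{2}}{m^{ -1}\sum_{e_{uv}\in E} \tfrac{1}{2}(d^{2}_{u}+d^{2}_{v})-\Big[m^{ -1}\sum_{e_{uv}\in E} \tfrac{1}{2}(d_{u}+d_{v})\Big]^{2}},$$ and $G$ is called neutral if $r$ is well defined (nonzero denominator) and $r=0$. -}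

module Defs where

open import Data.Bool using (Bool; true; false; if_then_else_; _∧_)
open import Data.Nat as ℕ using (ℕ; zero; suc; _+_; _*_; _≤_; _<ᵇ_)
open import Data.Fin using (Fin; toℕ; splitAt; _↑ˡ_; _↑ʳ_)
open import Data.Sum using (_⊎_; inj₁; inj₂)
open import Data.List using (List; []; _∷_; [_]; length; map; concatMap; allFin; _∷ʳ_)
open import Data.Nat.ListAction using (sum)
open import Data.List.Relation.Unary.Unique.Propositional using (Unique)
open import Data.List.Relation.Unary.Linked using (Linked)
open import Data.Product using (_×_; _,_; Σ; ∃; proj₁; proj₂)
open import Data.Maybe using (Maybe; just; nothing)
open import Data.Integer using (+_)
open import Data.Rational using (ℚ; 0ℚ; _-_; _÷_; _≟_; ≢-nonZero) renaming (_*_ to _*ℚ_; _/_ to _/ℚ_)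
open import Relation.Nullary using (¬_; yes; no)
open import Relation.Binary.PropositionalEquality using (_≡_; _≢_)

Graph : ℕ → Set
Graph n = Fin n → Fin n → Bool

record IsSimple {n : ℕ} (G : Graph n) : Set where
  field
    sym     : ∀ u v → G u v ≡ G v u
    irrefl  : ∀ v → G v v ≡ false

deg : {n : ℕ} → Graph n → Fin n → ℕ
deg {n} G v = sum (map (λ w → if G v w then 1 else 0) (allFin n))

edges : {n : ℕ} → Graph n → List (Fin n × Fin n)
edges {n} G =
  concatMap (λ u → concatMap (λ v → if (toℕ u <ᵇ toℕ v) ∧ G u v then [ (u , v) ] else [])
                             (allFin n))
            (allFin n)

data Walk {n : ℕ} (G : Graph n) : Fin n → Fin n → Set where
  here : ∀ {v} → Walk G v v
  step : ∀ {u w v} → G u w ≡ true → Walk G w v → Walk G u v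

Connected : {n : ℕ} → Graph n → Set
Connected G = ∀ u v → Walk G u v

Adj : {n : ℕ} → Graph n → Fin n → Fin n → Set
Adj G u v = G u v ≡ true

HasCycle : {n : ℕ} → Graph n → Set
HasCycle {n} G = Σ (Fin n) λ v → Σ (List (Fin n)) λ ws →
  (2 ≤ length ws) × Unique (v ∷ ws) × Linked (Adj G) ((v ∷ ws) ∷ʳ v)

IsTree : {n : ℕ} → Graph n → Set
IsTree G = IsSimple G × Connected G × ¬ HasCycle G

ratio : ℚ → ℚ → Maybe ℚ
ratio num den with den ≟ 0ℚ
... | yes _  = nothing
... | no ≢0 = just (_÷_ num den {{≢-nonZero ≢0}})

assort : {n : ℕ} → (Fin n → ℕ) → List (Fin n × Fin n) → Maybe ℚ
assort d es with length es
... | zero  = nothing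
... | suc k = ratio (A - B *ℚ B) (C - B *ℚ B)
  where
  q h : ℕ → ℚ
  q x = (+ x) /ℚ (suc k)
  h x = (+ x) /ℚ (2 * suc k)
  A = q (sum (map (λ e → d (proj₁ e) * d (proj₂ e)) es))
  B = h (sum (map (λ e → d (proj₁ e) + d (proj₂ e)) es))
  C = h (sum (map (λ e → d (proj₁ e) * d (proj₁ e) + d (proj₂ e) * d (proj₂ e)) es))

assortativity : {n : ℕ} → Graph n → Maybe ℚ
assortativity G = assort (deg G) (edges G)

Neutral : {n : ℕ} → Graph n → Set
Neutral G = assortativity G ≡ just 0ℚ

-- The k new leaves are Fin k; leaf l is attached to  owner l , and each
-- vertex v receives exactly d_v leaves.  The pairing of leaves is a
-- fixed-point-free involution  match  (leaf l is joined to leaf match l).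

count : {k : ℕ} → (Fin k → Bool) → ℕ
count {k} P = sum (map (λ l → if P l then 1 else 0) (allFin k))

record LeafConnection {n : ℕ} (T : Graph n) : Set where
  field
    k          : ℕ
    owner      : Fin k → Fin n
    ownerCount : ∀ v → count (λ l → toℕ (owner l) ℕ.≡ᵇ toℕ v) ≡ deg T v
    match      : Fin k → Fin k
    invol      : ∀ l → match (match l) ≡ l
    noFix      : ∀ l → match l ≢ l

-- the resulting graph T† on Fin (n + k): first n vertices = V(T), rest = leaves
_=ᵇ_ : {n : ℕ} → Fin n → Fin n → Bool
a =ᵇ b = toℕ a ℕ.≡ᵇ toℕ b

dagger : {n : ℕ} (T : Graph n) (L : LeafConnection T) → Graph (n + LeafConnection.k L)
dagger {n} T L x y with splitAt n x | splitAt n y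
... | inj₁ u | inj₁ v = T u v
... | inj₁ u | inj₂ l = LeafConnection.owner L l =ᵇ u
... | inj₂ l | inj₁ v = LeafConnection.owner L l =ᵇ v
... | inj₂ l | inj₂ l′ = LeafConnection.match L l =ᵇ l′

-- Let T have m edges and put P = Σ d_u d_v, Q = Σ (d_u + d_v), R = Σ (d_u² + d_v²), summed over
-- the edges uv.  Then r = (A − B²)/(C − B²) with A = P/m, B = Q/2m, C = R/2m.  In T† every old
-- vertex has twice its degree, the 2m new vertices have degree 2, and T† has 4m edges; this gives
-- A† = A + 2B + 1, B† = B + 1 and C† = 2C + 2.  So A = B² implies A† = B†², while
-- C† − B†² = 2(C − B²) + (B − 1)², which is positive because C ≥ B² (Cauchy–Schwarz) and C ≠ B².

module Submission where

open import Defs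
open import Data.Bool using (Bool; true; false; T; _∧_; if_then_else_)
open import Data.Empty using (⊥-elim)
open import Data.Fin using (Fin; zero; suc; toℕ; splitAt; _↑ˡ_; _↑ʳ_)
import Data.Fin.Properties as Fin
import Data.Integer as ℤ
import Data.Integer.Properties as ℤ
open import Data.List using (List; []; _∷_; [_]; _++_; length; map; concatMap; tabulate; allFin)
import Data.List.Properties as List
open import Data.Maybe using (just)
open import Data.Maybe.Properties using (just-injective)
open import Data.Nat using (ℕ; zero; suc; _+_; _*_; _≤_; _<_; _<ᵇ_; NonZero)
import Data.Nat.Properties as ℕ
open import Data.Nat.ListAction using (sum)
open import Data.Nat.ListAction.Properties using (sum-++)
open import Data.Nat.Tactic.RingSolver using (solve; solve-∀)
open import Data.Product using (_×_; _,_; proj₁; proj₂)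
open import Data.Product.Function.NonDependent.Propositional using (_×-⇔_)
open import Data.Rational as ℚ using (ℚ; 0ℚ; _/_; _-_; toℚᵘ)
import Data.Rational.Properties as ℚ
open import Data.Rational.Unnormalised as ℚᵘ using (mkℚᵘ; *≡*; _≃_)
import Data.Rational.Unnormalised.Properties as ℚᵘ
open import Data.Sum using (inj₁; inj₂)
open import Function using (_∘_; id; _⇔_; mk⇔; Equivalence)
open import Function.Construct.Composition using (_⇔-∘_)
open import Function.Related.TypeIsomorphisms using (¬-cong-⇔)
open import Relation.Binary.PropositionalEquality hiding ([_])
open import Relation.Nullary using (¬_; yes; no)
open import Algebra.Properties.Group ℚ.+-0-group using (x∙y⁻¹≈ε⇒x≈y; x≈y⇒x∙y⁻¹≈ε)
open import Algebra.Properties.Semiring.Sum ℕ.+-*-semiring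
  using (sum-syntax; sum-replicate-zero; sum-cong-≗; ∑-distrib-+; ∑-comm; *-distribˡ-sum; *-distribʳ-sum)

𝟙 : Bool → ℕ
𝟙 b = if b then 1 else 0

edgeSum : ∀ {n} → List (Fin n × Fin n) → (Fin n → Fin n → ℕ) → ℕ
edgeSum es h = sum (map (λ e → h (proj₁ e) (proj₂ e)) es)

-- Neutrality in terms of natural numbers

-- The numerator and denominator conditions of r = 0, multiplied out by (2m)².
record NeutralSums (m P Q R : ℕ) : Set where
  constructor neutralSums
  field
    numerator≡0   : 4 * m * P ≡ Q * Q
    denominator≢0 : 2 * m * R ≢ Q * Q

toℚᵘ-/suc : ∀ i n → toℚᵘ (i / suc n) ≃ mkℚᵘ i n
toℚᵘ-/suc i n = ℚ.toℚᵘ-fromℚᵘ (mkℚᵘ i n)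

/-≡-square⇔ : ∀ x y a b →
              (ℤ.+ x / suc a ≡ (ℤ.+ y / suc b) ℚ.* (ℤ.+ y / suc b)) ⇔ (x * (suc b * suc b) ≡ y * y * suc a)
/-≡-square⇔ x y a b = mk⇔
  (λ eq → fromℤ (ℚᵘ.≃-trans (ℚᵘ.≃-sym (toℚᵘ-/suc (ℤ.+ x) a)) (ℚᵘ.≃-trans (ℚ.toℚᵘ-cong eq) square)))
  (λ eq → ℚ.toℚᵘ-injective
    (ℚᵘ.≃-trans (toℚᵘ-/suc (ℤ.+ x) a) (ℚᵘ.≃-trans (*≡* (toℤ eq)) (ℚᵘ.≃-sym square))))
  where
  B : ℚ
  B = ℤ.+ y / suc b
  square : toℚᵘ (B ℚ.* B) ≃ mkℚᵘ (ℤ.+ y) b ℚᵘ.* mkℚᵘ (ℤ.+ y) b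
  square = ℚᵘ.≃-trans (ℚ.toℚᵘ-homo-* B B) (ℚᵘ.*-cong (toℚᵘ-/suc (ℤ.+ y) b) (toℚᵘ-/suc (ℤ.+ y) b))
  lhs : ℤ.+ x ℤ.* ℤ.+ (suc b * suc b) ≡ ℤ.+ (x * (suc b * suc b))
  lhs = sym (ℤ.pos-* x (suc b * suc b))
  rhs : (ℤ.+ y ℤ.* ℤ.+ y) ℤ.* ℤ.+ suc a ≡ ℤ.+ (y * y * suc a)
  rhs = trans (cong (ℤ._* ℤ.+ suc a) (sym (ℤ.pos-* y y))) (sym (ℤ.pos-* (y * y) (suc a)))
  toℤ : x * (suc b * suc b) ≡ y * y * suc a → ℤ.+ x ℤ.* ℤ.+ (suc b * suc b) ≡ (ℤ.+ y ℤ.* ℤ.+ y) ℤ.* ℤ.+ suc a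
  toℤ eq = trans lhs (trans (cong ℤ.+_ eq) (sym rhs))
  fromℤ : mkℚᵘ (ℤ.+ x) a ≃ mkℚᵘ (ℤ.+ y) b ℚᵘ.* mkℚᵘ (ℤ.+ y) b → x * (suc b * suc b) ≡ y * y * suc a
  fromℤ (*≡* eq) = ℤ.+-injective (trans (sym lhs) (trans eq rhs))

-≡0⇔≡ : ∀ p q → (p - q ≡ 0ℚ) ⇔ (p ≡ q)
-≡0⇔≡ p q = mk⇔ (x∙y⁻¹≈ε⇒x≈y p q) x≈y⇒x∙y⁻¹≈ε

÷≡0⇒≡0 : ∀ p q .{{_ : ℚ.NonZero q}} → (p ℚ.÷ q) ≡ 0ℚ → p ≡ 0ℚ
÷≡0⇒≡0 p q p÷q≡0 = begin
  p                       ≡⟨ ℚ.*-identityʳ p ⟨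
  p ℚ.* ℚ.1ℚ              ≡⟨ cong (p ℚ.*_) (ℚ.*-inverseˡ q) ⟨
  p ℚ.* (ℚ.1/ q ℚ.* q)    ≡⟨ ℚ.*-assoc p (ℚ.1/ q) q ⟨
  (p ℚ.÷ q) ℚ.* q         ≡⟨ cong (ℚ._* q) p÷q≡0 ⟩
  0ℚ ℚ.* q                ≡⟨ ℚ.*-zeroˡ q ⟩
  0ℚ                      ∎
  where open ≡-Reasoning

ratio≡just0⇔ : ∀ num den → (ratio num den ≡ just 0ℚ) ⇔ (num ≡ 0ℚ × den ≢ 0ℚ)
ratio≡just0⇔ num den with den ℚ.≟ 0ℚ
... | yes den≡0 = mk⇔ (λ ()) (λ (_ , den≢0) → ⊥-elim (den≢0 den≡0))
... | no den≢0  = mk⇔ (λ eq → ÷≡0⇒≡0 num den (just-injective eq) , den≢0)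
                      (λ { (refl , _) → cong just (ℚ.*-zeroˡ (ℚ.1/ den)) })
  where
  instance
    den-nonZero : ℚ.NonZero den
    den-nonZero = ℚ.≢-nonZero den≢0

scaled-≡⇔ : ∀ c .{{_ : NonZero c}} {x y a b} → x ≡ c * a → y ≡ c * b → (x ≡ y) ⇔ (a ≡ b)
scaled-≡⇔ c refl refl = mk⇔ (ℕ.*-cancelˡ-≡ _ _ c) (cong (c *_))

assort≡0⇔ : ∀ {n} (d : Fin n → ℕ) (es : List (Fin n × Fin n)) →
            (assort d es ≡ just 0ℚ) ⇔ NeutralSums (length es) (edgeSum es (λ u v → d u * d v))
                                       (edgeSum es (λ u v → d u + d v)) (edgeSum es (λ u v → d u * d u + d v * d v))
assort≡0⇔ d es with length es
... | zero  = mk⇔ (λ ()) (λ (neutralSums num den) → ⊥-elim (den num))  -- both conditions read 0 ≡ Q * Q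
... | suc k = mk⇔ (λ (num , den) → neutralSums num den) (λ (neutralSums num den) → num , den)
              ⇔-∘ ((numerator ×-⇔ ¬-cong-⇔ denominator) ⇔-∘ ratio≡just0⇔ _ _)
  where
  s P Q R : ℕ
  s = suc k
  P = edgeSum es (λ u v → d u * d v)
  Q = edgeSum es (λ u v → d u + d v)
  R = edgeSum es (λ u v → d u * d u + d v * d v)
  num-scale : ∀ s P → P * (2 * s * (2 * s)) ≡ s * (4 * s * P)
  num-scale = solve-∀
  den-scale : ∀ s R → R * (2 * s * (2 * s)) ≡ 2 * s * (2 * s * R)
  den-scale = solve-∀
  B : ℚ
  B = ℤ.+ Q / (2 * s)
  numerator : (ℤ.+ P / s - B ℚ.* B ≡ 0ℚ) ⇔ (4 * s * P ≡ Q * Q)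
  numerator = scaled-≡⇔ s (num-scale s P) (ℕ.*-comm (Q * Q) s)
              ⇔-∘ (/-≡-square⇔ P Q k _ ⇔-∘ -≡0⇔≡ _ _)
  denominator : (ℤ.+ R / (2 * s) - B ℚ.* B ≡ 0ℚ) ⇔ (2 * s * R ≡ Q * Q)
  denominator = scaled-≡⇔ (2 * s) (den-scale s R) (ℕ.*-comm (Q * Q) (2 * s))
                ⇔-∘ (/-≡-square⇔ R Q _ _ ⇔-∘ -≡0⇔≡ _ _)

-- Inequalities

private
  2*m*n≤m*m+n*n-ordered : ∀ {m n} → m ≤ n → 2 * m * n ≤ m * m + n * n
  2*m*n≤m*m+n*n-ordered {m} m≤n with ℕ.m≤n⇒∃[o]m+o≡n m≤n
  ... | o , refl = subst (2 * m * (m + o) ≤_) (square-gap m o) (ℕ.m≤m+n _ (o * o))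
    where
    square-gap : ∀ m o → 2 * m * (m + o) + o * o ≡ m * m + (m + o) * (m + o)
    square-gap = solve-∀

2*m*n≤m*m+n*n : ∀ m n → 2 * m * n ≤ m * m + n * n
2*m*n≤m*m+n*n m n with ℕ.≤-total m n
... | inj₁ m≤n = 2*m*n≤m*m+n*n-ordered m≤n
... | inj₂ n≤m = subst₂ _≤_ (swap n m) (ℕ.+-comm (n * n) (m * m)) (2*m*n≤m*m+n*n-ordered n≤m)
  where
  swap : ∀ n m → 2 * n * m ≡ 2 * m * n
  swap = solve-∀

sumOfSquares : List ℕ → ℕ
sumOfSquares xs = sum (map (λ x → x * x) xs)

2*x*sum≤length*x*x+sumOfSquares : ∀ x xs → 2 * x * sum xs ≤ length xs * (x * x) + sumOfSquares xs
2*x*sum≤length*x*x+sumOfSquares x []       = ℕ.≤-reflexive (ℕ.*-zeroʳ (2 * x))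
2*x*sum≤length*x*x+sumOfSquares x (y ∷ ys) = subst₂ _≤_
  (sym (ℕ.*-distribˡ-+ (2 * x) y (sum ys)))
  (interchange (x * x) (y * y) (length ys * (x * x)) (sumOfSquares ys))
  (ℕ.+-mono-≤ (2*m*n≤m*m+n*n x y) (2*x*sum≤length*x*x+sumOfSquares x ys))
  where
  interchange : ∀ a b c d → a + b + (c + d) ≡ a + c + (b + d)
  interchange = solve-∀

cauchy-schwarz : ∀ xs → sum xs * sum xs ≤ length xs * sumOfSquares xs
cauchy-schwarz []       = ℕ.≤-refl
cauchy-schwarz (x ∷ xs) = subst₂ _≤_
  (expand-square x (sum xs))
  (collect (x * x) (length xs) (sumOfSquares xs))
  (ℕ.+-mono-≤ (ℕ.+-monoʳ-≤ (x * x) (2*x*sum≤length*x*x+sumOfSquares x xs)) (cauchy-schwarz xs))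
  where
  expand-square : ∀ x s → x * x + 2 * x * s + s * s ≡ (x + s) * (x + s)
  expand-square = solve-∀
  collect : ∀ a l q → a + (l * a + q) + l * q ≡ a + q + l * (a + q)
  collect = solve-∀

module _ {n} (d : Fin n → ℕ) where

  endpointValues : List (Fin n × Fin n) → List ℕ
  endpointValues []             = []
  endpointValues ((u , v) ∷ es) = d u ∷ d v ∷ endpointValues es

  edgeSum-cauchy-schwarz : ∀ es → edgeSum es (λ u v → d u + d v) * edgeSum es (λ u v → d u + d v)
                                  ≤ 2 * length es * edgeSum es (λ u v → d u * d u + d v * d v)
  edgeSum-cauchy-schwarz es = subst₂ (λ S L → S * S ≤ L)
    (sum-endpointValues es) (cong₂ _*_ (length-endpointValues es) (sumOfSquares-endpointValues es))
    (cauchy-schwarz (endpointValues es))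
    where
    sum-endpointValues : ∀ es → sum (endpointValues es) ≡ edgeSum es (λ u v → d u + d v)
    sum-endpointValues []             = refl
    sum-endpointValues ((u , v) ∷ es) = trans (sym (ℕ.+-assoc (d u) (d v) _)) (cong ((d u + d v) +_) (sum-endpointValues es))
    sumOfSquares-endpointValues : ∀ es → sumOfSquares (endpointValues es) ≡ edgeSum es (λ u v → d u * d u + d v * d v)
    sumOfSquares-endpointValues []             = refl
    sumOfSquares-endpointValues ((u , v) ∷ es) =
      trans (sym (ℕ.+-assoc (d u * d u) (d v * d v) _)) (cong ((d u * d u + d v * d v) +_) (sumOfSquares-endpointValues es))
    length-endpointValues : ∀ es → length (endpointValues es) ≡ 2 * length es
    length-endpointValues []       = refl
    length-endpointValues (_ ∷ es) = trans (cong (2 +_) (length-endpointValues es)) (sym (ℕ.*-distribˡ-+ 2 1 (length es)))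

neutralSums-leafConnection : ∀ {m P Q R m′ P′ Q′ R′} → NeutralSums m P Q R → Q * Q ≤ 2 * m * R →
  m′ ≡ 4 * m → P′ ≡ 4 * (P + Q + m) → Q′ ≡ 4 * (Q + 2 * m) → R′ ≡ 8 * (R + 2 * m) →
  NeutralSums m′ P′ Q′ R′
neutralSums-leafConnection {m} {P} {Q} {R} (neutralSums num≡0 den≢0) Q²≤2mR refl refl refl refl =
  neutralSums num′≡0 (ℕ.<⇒≢ num′<den′ ∘ sym)
  where
  num′≡0 : 4 * (4 * m) * (4 * (P + Q + m)) ≡ 4 * (Q + 2 * m) * (4 * (Q + 2 * m))
  num′≡0 = begin
    4 * (4 * m) * (4 * (P + Q + m))                  ≡⟨ solve (m ∷ P ∷ Q ∷ []) ⟩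
    16 * (4 * m * P) + 64 * (m * Q) + 64 * (m * m)   ≡⟨ cong (λ x → 16 * x + 64 * (m * Q) + 64 * (m * m)) num≡0 ⟩
    16 * (Q * Q) + 64 * (m * Q) + 64 * (m * m)       ≡⟨ solve (m ∷ Q ∷ []) ⟩
    4 * (Q + 2 * m) * (4 * (Q + 2 * m))              ∎
    where open ≡-Reasoning
  num′<den′ : 4 * (Q + 2 * m) * (4 * (Q + 2 * m)) < 2 * (4 * m) * (8 * (R + 2 * m))
  num′<den′ = begin-strict
    4 * (Q + 2 * m) * (4 * (Q + 2 * m))                  ≡⟨ solve (m ∷ Q ∷ []) ⟩
    16 * (Q * Q) + 16 * (2 * Q * (2 * m)) + 64 * (m * m)
      ≤⟨ ℕ.+-monoˡ-≤ (64 * (m * m)) (ℕ.+-monoʳ-≤ (16 * (Q * Q)) (ℕ.*-monoʳ-≤ 16 (2*m*n≤m*m+n*n Q (2 * m)))) ⟩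
    16 * (Q * Q) + 16 * (Q * Q + 2 * m * (2 * m)) + 64 * (m * m) ≡⟨ solve (m ∷ Q ∷ []) ⟩
    32 * (Q * Q) + 128 * (m * m)
      <⟨ ℕ.+-monoˡ-< _ (ℕ.*-monoʳ-< 32 (ℕ.≤∧≢⇒< Q²≤2mR (den≢0 ∘ sym))) ⟩
    32 * (2 * m * R) + 128 * (m * m)                     ≡⟨ solve (m ∷ R ∷ []) ⟩
    2 * (4 * m) * (8 * (R + 2 * m))                      ∎
    where open ℕ.≤-Reasoning

-- Finite sums

sum-map-concatMap : ∀ {A B : Set} (h : B → ℕ) (f : A → List B) xs →
                    sum (map h (concatMap f xs)) ≡ sum (map (λ x → sum (map h (f x))) xs)
sum-map-concatMap h f []       = refl
sum-map-concatMap h f (x ∷ xs) = begin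
  sum (map h (f x ++ concatMap f xs))               ≡⟨ cong sum (List.map-++ h (f x) _) ⟩
  sum (map h (f x) ++ map h (concatMap f xs))       ≡⟨ sum-++ (map h (f x)) _ ⟩
  sum (map h (f x)) + sum (map h (concatMap f xs))  ≡⟨ cong (sum (map h (f x)) +_) (sum-map-concatMap h f xs) ⟩
  sum (map h (f x)) + sum (map (λ x → sum (map h (f x))) xs) ∎
  where open ≡-Reasoning

sum-tabulate : ∀ {n} (f : Fin n → ℕ) → sum (tabulate f) ≡ ∑[ i < n ] f i
sum-tabulate {zero}  f = refl
sum-tabulate {suc n} f = cong (f zero +_) (sum-tabulate (f ∘ suc))

sum-map-allFin : ∀ n (f : Fin n → ℕ) → sum (map f (allFin n)) ≡ ∑[ i < n ] f i
sum-map-allFin n f = trans (cong sum (List.map-tabulate id f)) (sum-tabulate f)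

∑-const : ∀ n c → ∑[ i < n ] c ≡ n * c
∑-const zero    c = refl
∑-const (suc n) c = cong (c +_) (∑-const n c)

∑-factorˡ : ∀ {n} c {f g : Fin n → ℕ} → (∀ i → f i ≡ c * g i) → ∑[ i < n ] f i ≡ c * ∑[ i < n ] g i
∑-factorˡ {n} c {g = g} f≡cg = trans (sum-cong-≗ {n} f≡cg) (sym (*-distribˡ-sum c g))

∑-↑ˡ-↑ʳ : ∀ n {k} (f : Fin (n + k) → ℕ) →
          ∑[ x < n + k ] f x ≡ ∑[ u < n ] f (u ↑ˡ k) + ∑[ l < k ] f (n ↑ʳ l)
∑-↑ˡ-↑ʳ zero    f = refl
∑-↑ˡ-↑ʳ (suc n) f = trans (cong (f zero +_) (∑-↑ˡ-↑ʳ n (f ∘ suc))) (sym (ℕ.+-assoc (f zero) _ _))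

∑-δ : ∀ {n} (a : Fin n) (f : Fin n → ℕ) → ∑[ u < n ] (𝟙 (a =ᵇ u) * f u) ≡ f a
∑-δ {suc n} zero    f = trans (cong₂ _+_ (ℕ.*-identityˡ (f zero)) (sum-replicate-zero n)) (ℕ.+-identityʳ (f zero))
∑-δ {suc n} (suc a) f = ∑-δ a (f ∘ suc)

∑-𝟙-=ᵇ : ∀ {n} (a : Fin n) → ∑[ u < n ] 𝟙 (a =ᵇ u) ≡ 1
∑-𝟙-=ᵇ {suc n} zero    = cong suc (sum-replicate-zero n)
∑-𝟙-=ᵇ {suc n} (suc a) = ∑-𝟙-=ᵇ a

-- Edge sums in simple graphs

adjSum : ∀ {n} → Graph n → (Fin n → Fin n → ℕ) → ℕ
adjSum {n} G h = ∑[ u < n ] ∑[ v < n ] (𝟙 (G u v) * h u v)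

<ᵇ≡true⇒< : ∀ {a b} → (a <ᵇ b) ≡ true → a < b
<ᵇ≡true⇒< {a} {b} e = ℕ.<ᵇ⇒< a b (subst T (sym e) _)

<ᵇ≡false⇒≮ : ∀ {a b} → (a <ᵇ b) ≡ false → ¬ a < b
<ᵇ≡false⇒≮ e a<b = subst T e (ℕ.<⇒<ᵇ a<b)

module _ {n} (G : Graph n) where

  upperAdj : Fin n → Fin n → Bool
  upperAdj u v = (toℕ u <ᵇ toℕ v) ∧ G u v

  edgeSum-edges : ∀ h → edgeSum (edges G) h ≡ ∑[ u < n ] ∑[ v < n ] (𝟙 (upperAdj u v) * h u v)
  edgeSum-edges h = begin
    sum (map H (concatMap row (allFin n)))          ≡⟨ sum-map-concatMap H row (allFin n) ⟩
    sum (map (λ u → sum (map H (row u))) (allFin n)) ≡⟨ sum-map-allFin n _ ⟩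
    ∑[ u < n ] sum (map H (row u))                   ≡⟨ sum-cong-≗ row-sum ⟩
    ∑[ u < n ] ∑[ v < n ] (𝟙 (upperAdj u v) * h u v) ∎
    where
    open ≡-Reasoning
    H : Fin n × Fin n → ℕ
    H e = h (proj₁ e) (proj₂ e)
    entry : Fin n → Fin n → List (Fin n × Fin n)
    entry u v = if upperAdj u v then [ (u , v) ] else []
    row : Fin n → List (Fin n × Fin n)
    row u = concatMap (entry u) (allFin n)
    entry-sum : ∀ u v → sum (map H (entry u v)) ≡ 𝟙 (upperAdj u v) * h u v
    entry-sum u v with upperAdj u v
    ... | true  = refl
    ... | false = refl
    row-sum : ∀ u → sum (map H (row u)) ≡ ∑[ v < n ] (𝟙 (upperAdj u v) * h u v)
    row-sum u = trans (sum-map-concatMap H (entry u) (allFin n)) (trans (sum-map-allFin n _) (sum-cong-≗ (entry-sum u)))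

  module _ (simple : IsSimple G) {h : Fin n → Fin n → ℕ} (h-sym : ∀ u v → h u v ≡ h v u) where
    open IsSimple simple renaming (sym to G-sym)

    adj-split : ∀ u v → 𝟙 (G u v) * h u v ≡ 𝟙 (upperAdj u v) * h u v + 𝟙 (upperAdj v u) * h v u
    adj-split u v with toℕ u <ᵇ toℕ v in u<v | toℕ v <ᵇ toℕ u in v<u
    ... | true  | true  = ⊥-elim (ℕ.<-asym (<ᵇ≡true⇒< {toℕ u} u<v) (<ᵇ≡true⇒< {toℕ v} v<u))
    ... | true  | false = sym (ℕ.+-identityʳ _)
    ... | false | true  = cong₂ (λ b x → 𝟙 b * x) (G-sym u v) (h-sym u v)
    ... | false | false = cong (λ b → 𝟙 b * h u v) (trans (cong (G u) (sym u≡v)) (irrefl u))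
      where
      u≡v : u ≡ v
      u≡v = Fin.toℕ-injective
        (ℕ.≤-antisym (ℕ.≮⇒≥ (<ᵇ≡false⇒≮ {toℕ v} v<u)) (ℕ.≮⇒≥ (<ᵇ≡false⇒≮ {toℕ u} u<v)))

    2*edgeSum≡adjSum : 2 * edgeSum (edges G) h ≡ adjSum G h
    2*edgeSum≡adjSum = begin
      2 * edgeSum (edges G) h                     ≡⟨ cong (2 *_) (edgeSum-edges h) ⟩
      2 * U                                       ≡⟨ cong (U +_) (ℕ.+-identityʳ U) ⟩
      U + U                                       ≡⟨ cong (U +_) (∑-comm (λ u v → upper v u)) ⟨
      U + ∑[ u < n ] ∑[ v < n ] upper v u         ≡⟨ ∑-distrib-+ {n} _ _ ⟨
      ∑[ u < n ] (∑[ v < n ] upper u v + ∑[ v < n ] upper v u) ≡⟨ sum-cong-≗ {n} (λ u → ∑-distrib-+ {n} _ _) ⟨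
      ∑[ u < n ] ∑[ v < n ] (upper u v + upper v u) ≡⟨ sum-cong-≗ {n} (λ u → sum-cong-≗ {n} (adj-split u)) ⟨
      adjSum G h                                  ∎
      where
      open ≡-Reasoning
      upper : Fin n → Fin n → ℕ
      upper u v = 𝟙 (upperAdj u v) * h u v
      U : ℕ
      U = ∑[ u < n ] ∑[ v < n ] upper u v

edgeSum-1≡length : ∀ {n} (es : List (Fin n × Fin n)) → edgeSum es (λ _ _ → 1) ≡ length es
edgeSum-1≡length []       = refl
edgeSum-1≡length (_ ∷ es) = cong suc (edgeSum-1≡length es)

adjSum-+ : ∀ {n} (G : Graph n) (f g : Fin n → Fin n → ℕ) →
           adjSum G (λ u v → f u v + g u v) ≡ adjSum G f + adjSum G g
adjSum-+ {n} G f g = trans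
  (sum-cong-≗ {n} λ u → trans (sum-cong-≗ {n} λ v → ℕ.*-distribˡ-+ (𝟙 (G u v)) (f u v) (g u v)) (∑-distrib-+ {n} _ _))
  (∑-distrib-+ {n} _ _)

module _ {n} {G : Graph n} (simple : IsSimple G) where
  open IsSimple simple renaming (sym to G-sym)

  adjSum-source : ∀ (φ : Fin n → ℕ) → adjSum G (λ u _ → φ u) ≡ ∑[ u < n ] (deg G u * φ u)
  adjSum-source φ = sum-cong-≗ {n} λ u → begin
    ∑[ v < n ] (𝟙 (G u v) * φ u) ≡⟨ *-distribʳ-sum {n} (φ u) _ ⟨
    ∑[ v < n ] 𝟙 (G u v) * φ u   ≡⟨ cong (_* φ u) (sum-map-allFin n (λ v → 𝟙 (G u v))) ⟨
    deg G u * φ u                ∎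
    where open ≡-Reasoning

  adjSum-target : ∀ (φ : Fin n → ℕ) → adjSum G (λ _ v → φ v) ≡ ∑[ u < n ] (deg G u * φ u)
  adjSum-target φ = begin
    adjSum G (λ _ v → φ v)                       ≡⟨ ∑-comm (λ u v → 𝟙 (G u v) * φ v) ⟩
    ∑[ v < n ] ∑[ u < n ] (𝟙 (G u v) * φ v)
      ≡⟨ sum-cong-≗ {n} (λ v → sum-cong-≗ {n} λ u → cong (λ b → 𝟙 b * φ v) (G-sym u v)) ⟩
    adjSum G (λ v _ → φ v)                       ≡⟨ adjSum-source φ ⟩
    ∑[ u < n ] (deg G u * φ u)                   ∎
    where open ≡-Reasoning

  edgeSum-ends : ∀ (φ : Fin n → ℕ) → edgeSum (edges G) (λ u v → φ u + φ v) ≡ ∑[ u < n ] (deg G u * φ u)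
  edgeSum-ends φ = ℕ.*-cancelˡ-≡ _ _ 2 (begin
    2 * edgeSum (edges G) (λ u v → φ u + φ v) ≡⟨ 2*edgeSum≡adjSum G simple (λ u v → ℕ.+-comm (φ u) (φ v)) ⟩
    adjSum G (λ u v → φ u + φ v)              ≡⟨ adjSum-+ G _ _ ⟩
    adjSum G (λ u _ → φ u) + adjSum G (λ _ v → φ v) ≡⟨ cong₂ _+_ (adjSum-source φ) (adjSum-target φ) ⟩
    D + D                                     ≡⟨ cong (D +_) (ℕ.+-identityʳ D) ⟨
    2 * D                                     ∎)
    where
    open ≡-Reasoning
    D : ℕ
    D = ∑[ u < n ] (deg G u * φ u)

  handshake : 2 * length (edges G) ≡ ∑[ u < n ] deg G u
  handshake = begin
    2 * length (edges G)              ≡⟨ cong (2 *_) (edgeSum-1≡length (edges G)) ⟨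
    2 * edgeSum (edges G) (λ _ _ → 1) ≡⟨ 2*edgeSum≡adjSum G simple (λ _ _ → refl) ⟩
    adjSum G (λ _ _ → 1)              ≡⟨ adjSum-source (λ _ → 1) ⟩
    ∑[ u < n ] (deg G u * 1)          ≡⟨ sum-cong-≗ {n} (λ u → ℕ.*-identityʳ (deg G u)) ⟩
    ∑[ u < n ] deg G u                ∎
    where open ≡-Reasoning

-- The leaf-connecting operation

T-injective : ∀ {a b} → (T a → T b) → (T b → T a) → a ≡ b
T-injective {false} {false} _   _   = refl
T-injective {false} {true}  _   b⇒a = ⊥-elim (b⇒a _)
T-injective {true}  {false} a⇒b _   = ⊥-elim (a⇒b _)
T-injective {true}  {true}  _   _   = refl

=ᵇ⇒≡ : ∀ {m} {a b : Fin m} → T (a =ᵇ b) → a ≡ b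
=ᵇ⇒≡ {a = a} {b} t = Fin.toℕ-injective (ℕ.≡ᵇ⇒≡ (toℕ a) (toℕ b) t)

≡⇒=ᵇ : ∀ {m} {a b : Fin m} → a ≡ b → T (a =ᵇ b)
≡⇒=ᵇ {a = a} {b} a≡b = ℕ.≡⇒≡ᵇ (toℕ a) (toℕ b) (cong toℕ a≡b)

module _ {n} (G : Graph n) where

  edgeDegProducts edgeDegSums edgeDegSquares : ℕ
  edgeDegProducts = edgeSum (edges G) (λ u v → deg G u * deg G v)
  edgeDegSums     = edgeSum (edges G) (λ u v → deg G u + deg G v)
  edgeDegSquares  = edgeSum (edges G) (λ u v → deg G u * deg G u + deg G v * deg G v)

  Neutral⇔NeutralSums : Neutral G ⇔ NeutralSums (length (edges G)) edgeDegProducts edgeDegSums edgeDegSquares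
  Neutral⇔NeutralSums = assort≡0⇔ (deg G) (edges G)

module _ {n} {G : Graph n} (simple : IsSimple G) where

  2*edgeDegProducts≡adjSum : 2 * edgeDegProducts G ≡ adjSum G (λ u v → deg G u * deg G v)
  2*edgeDegProducts≡adjSum = 2*edgeSum≡adjSum G simple (λ u v → ℕ.*-comm (deg G u) (deg G v))

  edgeDegSums≡∑deg² : edgeDegSums G ≡ ∑[ u < n ] (deg G u * deg G u)
  edgeDegSums≡∑deg² = edgeSum-ends simple (deg G)

  edgeDegSquares≡∑deg³ : edgeDegSquares G ≡ ∑[ u < n ] (deg G u * (deg G u * deg G u))
  edgeDegSquares≡∑deg³ = edgeSum-ends simple (λ u → deg G u * deg G u)

module Dagger {n} (G : Graph n) (L : LeafConnection G) where
  open LeafConnection L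

  G† : Graph (n + k)
  G† = dagger G L

  G†-↑ˡ-↑ˡ : ∀ u v → G† (u ↑ˡ k) (v ↑ˡ k) ≡ G u v
  G†-↑ˡ-↑ˡ u v rewrite Fin.splitAt-↑ˡ n u k | Fin.splitAt-↑ˡ n v k = refl

  G†-↑ˡ-↑ʳ : ∀ u l → G† (u ↑ˡ k) (n ↑ʳ l) ≡ owner l =ᵇ u
  G†-↑ˡ-↑ʳ u l rewrite Fin.splitAt-↑ˡ n u k | Fin.splitAt-↑ʳ n k l = refl

  G†-↑ʳ-↑ˡ : ∀ l u → G† (n ↑ʳ l) (u ↑ˡ k) ≡ owner l =ᵇ u
  G†-↑ʳ-↑ˡ l u rewrite Fin.splitAt-↑ˡ n u k | Fin.splitAt-↑ʳ n k l = refl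

  G†-↑ʳ-↑ʳ : ∀ l l′ → G† (n ↑ʳ l) (n ↑ʳ l′) ≡ match l =ᵇ l′
  G†-↑ʳ-↑ʳ l l′ rewrite Fin.splitAt-↑ʳ n k l | Fin.splitAt-↑ʳ n k l′ = refl

  match-=ᵇ-sym : ∀ l l′ → (match l =ᵇ l′) ≡ (match l′ =ᵇ l)
  match-=ᵇ-sym l l′ = T-injective (flip l l′) (flip l′ l)
    where
    flip : ∀ a b → T (match a =ᵇ b) → T (match b =ᵇ a)
    flip a b t = ≡⇒=ᵇ (trans (cong match (sym (=ᵇ⇒≡ t))) (invol a))

  match-=ᵇ-irrefl : ∀ l → (match l =ᵇ l) ≡ false
  match-=ᵇ-irrefl l = T-injective (noFix l ∘ =ᵇ⇒≡) λ ()

  G†-simple : IsSimple G → IsSimple G†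
  G†-simple simple = record { sym = G†-sym ; irrefl = G†-irrefl }
    where
    G†-sym : ∀ x y → G† x y ≡ G† y x
    G†-sym x y with splitAt n x | splitAt n y
    ... | inj₁ u | inj₁ v  = IsSimple.sym simple u v
    ... | inj₁ u | inj₂ l  = refl
    ... | inj₂ l | inj₁ v  = refl
    ... | inj₂ l | inj₂ l′ = match-=ᵇ-sym l l′
    G†-irrefl : ∀ x → G† x x ≡ false
    G†-irrefl x with splitAt n x
    ... | inj₁ u = IsSimple.irrefl simple u
    ... | inj₂ l = match-=ᵇ-irrefl l

  ∑-𝟙-owner≡deg : ∀ u → ∑[ l < k ] 𝟙 (owner l =ᵇ u) ≡ deg G u
  ∑-𝟙-owner≡deg u = trans (sym (sum-map-allFin k _)) (ownerCount u)

  ∑-owner : ∀ (f : Fin n → ℕ) → ∑[ l < k ] f (owner l) ≡ ∑[ u < n ] (deg G u * f u)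
  ∑-owner f = begin
    ∑[ l < k ] f (owner l)                          ≡⟨ sum-cong-≗ {k} (λ l → ∑-δ (owner l) f) ⟨
    ∑[ l < k ] ∑[ u < n ] (𝟙 (owner l =ᵇ u) * f u)  ≡⟨ ∑-comm (λ l u → 𝟙 (owner l =ᵇ u) * f u) ⟩
    ∑[ u < n ] ∑[ l < k ] (𝟙 (owner l =ᵇ u) * f u)  ≡⟨ sum-cong-≗ {n} (λ u → *-distribʳ-sum {k} (f u) _) ⟨
    ∑[ u < n ] (∑[ l < k ] 𝟙 (owner l =ᵇ u) * f u)  ≡⟨ sum-cong-≗ {n} (λ u → cong (_* f u) (∑-𝟙-owner≡deg u)) ⟩
    ∑[ u < n ] (deg G u * f u)                      ∎
    where open ≡-Reasoning

  k≡∑deg : k ≡ ∑[ u < n ] deg G u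
  k≡∑deg = begin
    k                          ≡⟨ ℕ.*-identityʳ k ⟨
    k * 1                      ≡⟨ ∑-const k 1 ⟨
    ∑[ l < k ] 1               ≡⟨ ∑-owner (λ _ → 1) ⟩
    ∑[ u < n ] (deg G u * 1)   ≡⟨ sum-cong-≗ {n} (λ u → ℕ.*-identityʳ (deg G u)) ⟩
    ∑[ u < n ] deg G u         ∎
    where open ≡-Reasoning

  deg-G†-↑ˡ : ∀ u → deg G† (u ↑ˡ k) ≡ 2 * deg G u
  deg-G†-↑ˡ u = begin
    deg G† (u ↑ˡ k)                                  ≡⟨ sum-map-allFin (n + k) _ ⟩
    ∑[ y < n + k ] 𝟙 (G† (u ↑ˡ k) y)                 ≡⟨ ∑-↑ˡ-↑ʳ n _ ⟩
    ∑[ v < n ] 𝟙 (G† (u ↑ˡ k) (v ↑ˡ k)) + ∑[ l < k ] 𝟙 (G† (u ↑ˡ k) (n ↑ʳ l))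
      ≡⟨ cong₂ _+_ (sum-cong-≗ {n} (cong 𝟙 ∘ G†-↑ˡ-↑ˡ u)) (sum-cong-≗ {k} (cong 𝟙 ∘ G†-↑ˡ-↑ʳ u)) ⟩
    ∑[ v < n ] 𝟙 (G u v) + ∑[ l < k ] 𝟙 (owner l =ᵇ u) ≡⟨ cong₂ _+_ (sym (sum-map-allFin n _)) (∑-𝟙-owner≡deg u) ⟩
    deg G u + deg G u                                ≡⟨ cong (deg G u +_) (ℕ.+-identityʳ (deg G u)) ⟨
    2 * deg G u                                      ∎
    where open ≡-Reasoning

  deg-G†-↑ʳ : ∀ l → deg G† (n ↑ʳ l) ≡ 2
  deg-G†-↑ʳ l = begin
    deg G† (n ↑ʳ l)                                  ≡⟨ sum-map-allFin (n + k) _ ⟩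
    ∑[ y < n + k ] 𝟙 (G† (n ↑ʳ l) y)                 ≡⟨ ∑-↑ˡ-↑ʳ n _ ⟩
    ∑[ v < n ] 𝟙 (G† (n ↑ʳ l) (v ↑ˡ k)) + ∑[ l′ < k ] 𝟙 (G† (n ↑ʳ l) (n ↑ʳ l′))
      ≡⟨ cong₂ _+_ (sum-cong-≗ {n} (cong 𝟙 ∘ G†-↑ʳ-↑ˡ l)) (sum-cong-≗ {k} (cong 𝟙 ∘ G†-↑ʳ-↑ʳ l)) ⟩
    ∑[ v < n ] 𝟙 (owner l =ᵇ v) + ∑[ l′ < k ] 𝟙 (match l =ᵇ l′)
      ≡⟨ cong₂ _+_ (∑-𝟙-=ᵇ (owner l)) (∑-𝟙-=ᵇ (match l)) ⟩
    2                                                ∎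
    where open ≡-Reasoning

  ∑-deg-G† : ∀ (f : ℕ → ℕ) → ∑[ x < n + k ] f (deg G† x) ≡ ∑[ u < n ] f (2 * deg G u) + k * f 2
  ∑-deg-G† f = trans (∑-↑ˡ-↑ʳ n _) (cong₂ _+_
    (sum-cong-≗ {n} (cong f ∘ deg-G†-↑ˡ))
    (trans (sum-cong-≗ {k} (cong f ∘ deg-G†-↑ʳ)) (∑-const k (f 2))))

  adjSum-G† : ∀ h → adjSum G† h ≡ adjSum G (λ u v → h (u ↑ˡ k) (v ↑ˡ k))
    + ∑[ l < k ] (h (owner l ↑ˡ k) (n ↑ʳ l) + h (n ↑ʳ l) (owner l ↑ˡ k) + h (n ↑ʳ l) (n ↑ʳ match l))
  adjSum-G† h = begin
    adjSum G† h
      ≡⟨ ∑-↑ˡ-↑ʳ n _ ⟩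
    ∑[ u < n ] row (u ↑ˡ k) + ∑[ l < k ] row (n ↑ʳ l)
      ≡⟨ cong₂ _+_ (sum-cong-≗ {n} (λ u → ∑-↑ˡ-↑ʳ n _)) (sum-cong-≗ {k} (λ l → ∑-↑ˡ-↑ʳ n _)) ⟩
    ∑[ u < n ] (∑[ v < n ] A (u ↑ˡ k) (v ↑ˡ k) + ∑[ l < k ] A (u ↑ˡ k) (n ↑ʳ l))
      + ∑[ l < k ] (∑[ u < n ] A (n ↑ʳ l) (u ↑ˡ k) + ∑[ l′ < k ] A (n ↑ʳ l) (n ↑ʳ l′))
      ≡⟨ cong₂ _+_ (∑-distrib-+ {n} _ _) (∑-distrib-+ {k} _ _) ⟩
    (∑[ u < n ] ∑[ v < n ] A (u ↑ˡ k) (v ↑ˡ k) + ∑[ u < n ] ∑[ l < k ] A (u ↑ˡ k) (n ↑ʳ l))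
      + (∑[ l < k ] ∑[ u < n ] A (n ↑ʳ l) (u ↑ˡ k) + ∑[ l < k ] ∑[ l′ < k ] A (n ↑ʳ l) (n ↑ʳ l′))
      ≡⟨ cong₂ _+_ (cong₂ _+_ core-core core-leaf) (cong₂ _+_ leaf-core leaf-leaf) ⟩
    (adjSum G h↑ + ∑[ l < k ] toLeaf l) + (∑[ l < k ] fromLeaf l + ∑[ l < k ] matched l)
      ≡⟨ ℕ.+-assoc (adjSum G h↑) _ _ ⟩
    adjSum G h↑ + (∑[ l < k ] toLeaf l + (∑[ l < k ] fromLeaf l + ∑[ l < k ] matched l))
      ≡⟨ cong (adjSum G h↑ +_) (ℕ.+-assoc (∑[ l < k ] toLeaf l) _ _) ⟨
    adjSum G h↑ + (∑[ l < k ] toLeaf l + ∑[ l < k ] fromLeaf l + ∑[ l < k ] matched l)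
      ≡⟨ cong (adjSum G h↑ +_) leaf-sums ⟩
    adjSum G h↑ + ∑[ l < k ] (toLeaf l + fromLeaf l + matched l) ∎
    where
    open ≡-Reasoning
    A : Fin (n + k) → Fin (n + k) → ℕ
    A x y = 𝟙 (G† x y) * h x y
    row : Fin (n + k) → ℕ
    row x = ∑[ y < n + k ] A x y
    h↑ : Fin n → Fin n → ℕ
    h↑ u v = h (u ↑ˡ k) (v ↑ˡ k)
    toLeaf fromLeaf matched : Fin k → ℕ
    toLeaf   l = h (owner l ↑ˡ k) (n ↑ʳ l)
    fromLeaf l = h (n ↑ʳ l) (owner l ↑ˡ k)
    matched  l = h (n ↑ʳ l) (n ↑ʳ match l)
    leaf-sums : ∑[ l < k ] toLeaf l + ∑[ l < k ] fromLeaf l + ∑[ l < k ] matched l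
              ≡ ∑[ l < k ] (toLeaf l + fromLeaf l + matched l)
    leaf-sums = trans (cong (_+ ∑[ l < k ] matched l) (sym (∑-distrib-+ toLeaf fromLeaf)))
                      (sym (∑-distrib-+ (λ l → toLeaf l + fromLeaf l) matched))
    weight : ∀ {x y b} → G† x y ≡ b → A x y ≡ 𝟙 b * h x y
    weight = cong (λ b → 𝟙 b * _)
    core-core : ∑[ u < n ] ∑[ v < n ] A (u ↑ˡ k) (v ↑ˡ k) ≡ adjSum G h↑
    core-core = sum-cong-≗ {n} λ u → sum-cong-≗ {n} λ v → weight (G†-↑ˡ-↑ˡ u v)
    core-leaf : ∑[ u < n ] ∑[ l < k ] A (u ↑ˡ k) (n ↑ʳ l) ≡ ∑[ l < k ] toLeaf l
    core-leaf = trans (sum-cong-≗ {n} λ u → sum-cong-≗ {k} λ l → weight (G†-↑ˡ-↑ʳ u l))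
                (trans (∑-comm (λ u l → 𝟙 (owner l =ᵇ u) * h (u ↑ˡ k) (n ↑ʳ l)))
                       (sum-cong-≗ {k} λ l → ∑-δ (owner l) (λ u → h (u ↑ˡ k) (n ↑ʳ l))))
    leaf-core : ∑[ l < k ] ∑[ u < n ] A (n ↑ʳ l) (u ↑ˡ k) ≡ ∑[ l < k ] fromLeaf l
    leaf-core = sum-cong-≗ {k} λ l → trans (sum-cong-≗ {n} λ u → weight (G†-↑ʳ-↑ˡ l u))
                                           (∑-δ (owner l) (λ u → h (n ↑ʳ l) (u ↑ˡ k)))
    leaf-leaf : ∑[ l < k ] ∑[ l′ < k ] A (n ↑ʳ l) (n ↑ʳ l′) ≡ ∑[ l < k ] matched l
    leaf-leaf = sum-cong-≗ {k} λ l → trans (sum-cong-≗ {k} λ l′ → weight (G†-↑ʳ-↑ʳ l l′))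
                                           (∑-δ (match l) (λ l′ → h (n ↑ʳ l) (n ↑ʳ l′)))

  module _ (simple : IsSimple G) where
    private
      m : ℕ
      m = length (edges G)
      simple† : IsSimple G†
      simple† = G†-simple simple

    k≡2m : k ≡ 2 * m
    k≡2m = trans k≡∑deg (sym (handshake simple))

    size-G† : length (edges G†) ≡ 4 * m
    size-G† = ℕ.*-cancelˡ-≡ _ _ 2 (begin
      2 * length (edges G†)                   ≡⟨ handshake simple† ⟩
      ∑[ x < n + k ] deg G† x                 ≡⟨ ∑-deg-G† id ⟩
      ∑[ u < n ] (2 * deg G u) + k * 2        ≡⟨ cong₂ _+_ (sym (*-distribˡ-sum 2 (deg G))) (cong (_* 2) k≡2m) ⟩
      2 * ∑[ u < n ] deg G u + 2 * m * 2      ≡⟨ cong (λ D → 2 * D + 2 * m * 2) (handshake simple) ⟨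
      2 * (2 * m) + 2 * m * 2                 ≡⟨ regroup m ⟩
      2 * (4 * m)                             ∎)
      where
      open ≡-Reasoning
      regroup : ∀ m → 2 * (2 * m) + 2 * m * 2 ≡ 2 * (4 * m)
      regroup = solve-∀

    edgeDegSums-G† : edgeDegSums G† ≡ 4 * (edgeDegSums G + 2 * m)
    edgeDegSums-G† = begin
      edgeDegSums G†                                     ≡⟨ edgeDegSums≡∑deg² simple† ⟩
      ∑[ x < n + k ] (deg G† x * deg G† x)               ≡⟨ ∑-deg-G† (λ a → a * a) ⟩
      ∑[ u < n ] (2 * deg G u * (2 * deg G u)) + k * 4
        ≡⟨ cong₂ _+_ (∑-factorˡ 4 (λ u → square-of-double (deg G u))) (cong (_* 4) k≡2m) ⟩
      4 * ∑[ u < n ] (deg G u * deg G u) + 2 * m * 4     ≡⟨ cong (λ Q → 4 * Q + 2 * m * 4) (edgeDegSums≡∑deg² simple) ⟨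
      4 * edgeDegSums G + 2 * m * 4                      ≡⟨ regroup (edgeDegSums G) m ⟩
      4 * (edgeDegSums G + 2 * m)                        ∎
      where
      open ≡-Reasoning
      square-of-double : ∀ a → 2 * a * (2 * a) ≡ 4 * (a * a)
      square-of-double = solve-∀
      regroup : ∀ Q m → 4 * Q + 2 * m * 4 ≡ 4 * (Q + 2 * m)
      regroup = solve-∀

    edgeDegSquares-G† : edgeDegSquares G† ≡ 8 * (edgeDegSquares G + 2 * m)
    edgeDegSquares-G† = begin
      edgeDegSquares G†                                  ≡⟨ edgeDegSquares≡∑deg³ simple† ⟩
      ∑[ x < n + k ] (deg G† x * (deg G† x * deg G† x))  ≡⟨ ∑-deg-G† (λ a → a * (a * a)) ⟩
      ∑[ u < n ] (2 * deg G u * (2 * deg G u * (2 * deg G u))) + k * 8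
        ≡⟨ cong₂ _+_ (∑-factorˡ 8 (λ u → cube-of-double (deg G u))) (cong (_* 8) k≡2m) ⟩
      8 * ∑[ u < n ] (deg G u * (deg G u * deg G u)) + 2 * m * 8
        ≡⟨ cong (λ R → 8 * R + 2 * m * 8) (edgeDegSquares≡∑deg³ simple) ⟨
      8 * edgeDegSquares G + 2 * m * 8                   ≡⟨ regroup (edgeDegSquares G) m ⟩
      8 * (edgeDegSquares G + 2 * m)                     ∎
      where
      open ≡-Reasoning
      cube-of-double : ∀ a → 2 * a * (2 * a * (2 * a)) ≡ 8 * (a * (a * a))
      cube-of-double = solve-∀
      regroup : ∀ R m → 8 * R + 2 * m * 8 ≡ 8 * (R + 2 * m)
      regroup = solve-∀

    edgeDegProducts-G† : edgeDegProducts G† ≡ 4 * (edgeDegProducts G + edgeDegSums G + m)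
    edgeDegProducts-G† = ℕ.*-cancelˡ-≡ _ _ 2 (begin
      2 * edgeDegProducts G†                               ≡⟨ 2*edgeDegProducts≡adjSum simple† ⟩
      adjSum G† (λ x y → deg G† x * deg G† y)              ≡⟨ adjSum-G† _ ⟩
      adjSum G (λ u v → deg G† (u ↑ˡ k) * deg G† (v ↑ˡ k)) + ∑[ l < k ] leafTerms l
        ≡⟨ cong₂ _+_ core-edges leaf-edges ⟩
      4 * adjSum G (λ u v → deg G u * deg G v) + (8 * ∑[ u < n ] (deg G u * deg G u) + k * 4)
        ≡⟨ cong₂ (λ P Q → 4 * P + (8 * Q + k * 4)) (2*edgeDegProducts≡adjSum simple) (edgeDegSums≡∑deg² simple) ⟨
      4 * (2 * edgeDegProducts G) + (8 * edgeDegSums G + k * 4)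
        ≡⟨ cong (λ k → 4 * (2 * edgeDegProducts G) + (8 * edgeDegSums G + k * 4)) k≡2m ⟩
      4 * (2 * edgeDegProducts G) + (8 * edgeDegSums G + 2 * m * 4)
        ≡⟨ regroup (edgeDegProducts G) (edgeDegSums G) m ⟩
      2 * (4 * (edgeDegProducts G + edgeDegSums G + m))    ∎)
      where
      open ≡-Reasoning
      leafTerms : Fin k → ℕ
      leafTerms l = deg G† (owner l ↑ˡ k) * deg G† (n ↑ʳ l) + deg G† (n ↑ʳ l) * deg G† (owner l ↑ˡ k)
                  + deg G† (n ↑ʳ l) * deg G† (n ↑ʳ match l)
      core-edges : adjSum G (λ u v → deg G† (u ↑ˡ k) * deg G† (v ↑ˡ k)) ≡ 4 * adjSum G (λ u v → deg G u * deg G v)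
      core-edges = ∑-factorˡ 4 λ u → ∑-factorˡ 4 λ v →
        trans (cong₂ (λ a c → 𝟙 (G u v) * (a * c)) (deg-G†-↑ˡ u) (deg-G†-↑ˡ v))
              (product-of-doubles (𝟙 (G u v)) (deg G u) (deg G v))
        where
        product-of-doubles : ∀ i a c → i * (2 * a * (2 * c)) ≡ 4 * (i * (a * c))
        product-of-doubles = solve-∀
      leaf-edges : ∑[ l < k ] leafTerms l ≡ 8 * ∑[ u < n ] (deg G u * deg G u) + k * 4
      leaf-edges = begin
        ∑[ l < k ] leafTerms l                        ≡⟨ sum-cong-≗ {k} leafTerm ⟩
        ∑[ l < k ] (8 * deg G (owner l) + 4)          ≡⟨ ∑-distrib-+ {k} _ _ ⟩
        ∑[ l < k ] (8 * deg G (owner l)) + ∑[ l < k ] 4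
          ≡⟨ cong₂ _+_ (sym (*-distribˡ-sum 8 (deg G ∘ owner))) (∑-const k 4) ⟩
        8 * ∑[ l < k ] deg G (owner l) + k * 4        ≡⟨ cong (λ s → 8 * s + k * 4) (∑-owner (deg G)) ⟩
        8 * ∑[ u < n ] (deg G u * deg G u) + k * 4    ∎
        where
        leafTerms-value : ∀ a → 2 * a * 2 + 2 * (2 * a) + 2 * 2 ≡ 8 * a + 4
        leafTerms-value = solve-∀
        leafTerm : ∀ l → leafTerms l ≡ 8 * deg G (owner l) + 4
        leafTerm l rewrite deg-G†-↑ˡ (owner l) | deg-G†-↑ʳ l | deg-G†-↑ʳ (match l) = leafTerms-value (deg G (owner l))
      regroup : ∀ P Q m → 4 * (2 * P) + (8 * Q + 2 * m * 4) ≡ 2 * (4 * (P + Q + m))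
      regroup = solve-∀

lemma4 : {n₁ : ℕ} (T : Graph n₁) → 7 ≤ n₁ → IsTree T → Neutral T →
    (L : LeafConnection T) → Neutral (dagger T L)
lemma4 T _ (simple , _) neutral L =
  Equivalence.from (Neutral⇔NeutralSums G†)
    (neutralSums-leafConnection
      (Equivalence.to (Neutral⇔NeutralSums T) neutral)
      (edgeSum-cauchy-schwarz (deg T) (edges T))
      (size-G† simple) (edgeDegProducts-G† simple) (edgeDegSums-G† simple) (edgeDegSquares-G† simple))
  where open Dagger T L
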